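{- Let $p$ be a prime and let $A,B,C\subset \mathbb{F}_p^*$ be nonempty sets. Then $$|AB|\cdot|(A+1)C|\gg \min\Bigl\{p\,|A|,\ \frac{|A|^2\cdot|B|\cdot|C|}{p}\Bigr\},$$ where the implied constant is absolute.
   Context: $\mathbb{F}_p$ is the field with $p$ elements and $\mathbb{F}_p^*=\mathbb{F}_p\setminus\{0\}$. For sets $X,Y$, $XY=\{xy: x\in X, y\in Y\}$ and $X+1=\{x+1:x\in X\}$. The notation $U\gg V$ means $U\ge cV$ for some absolute constant $c>0$. -}

module Defs where

open import Data.Nat using (ℕ; NonZero; _+_; _*_)
open import Data.Nat.DivMod using (_mod_)
open import Data.Fin using (Fin; toℕ)
open import Data.Fin.Subset using (Subset; _∈_)
open import Data.Fin.Subset.Properties using (_∈?_)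
open import Data.Fin.Properties using (any?; _≟_)
open import Data.Vec using (tabulate)
open import Data.Product using (_×_)
open import Relation.Nullary using (does)
open import Relation.Binary.PropositionalEquality using (_≢_)
open import Relation.Nullary.Decidable using (_×-dec_)

-- Field operations of 𝔽_p, with 𝔽_p represented by Fin p (residues 0..p-1).
mulF : (p : ℕ) → .{{NonZero p}} → Fin p → Fin p → Fin p
mulF p a b = (toℕ a * toℕ b) mod p

succF : (p : ℕ) → .{{NonZero p}} → Fin p → Fin p
succF p a = (toℕ a + 1) mod p

prodSet : (p : ℕ) → .{{NonZero p}} → Subset p → Subset p → Subset p
prodSet p X Y = tabulate λ z →
  does (any? λ x → any? λ y → (x ∈? X) ×-dec ((y ∈? Y) ×-dec (mulF p x y ≟ z)))

shiftSet : (p : ℕ) → .{{NonZero p}} → Subset p → Subset p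
shiftSet p X = tabulate λ z → does (any? λ x → (x ∈? X) ×-dec (succF p x ≟ z))

InUnits : (p : ℕ) → Subset p → Set
InUnits p X = ∀ x → x ∈ X → toℕ x ≢ 0

module Submission where

-- The lines ℓ(b,c) = {(ab, (a+1)c) : a ∈ 𝔽_p}, (b,c) ∈ B × C, are
-- L = |B||C| distinct lines; each passes through at least |A| points of the grid
-- P = AB × (A+1)C, which has n = |AB||(A+1)C| points.  Let r(q) be the number of these
-- lines through q ∈ 𝔽_p².  Then ∑ r = pL, and since two distinct such lines meet at most
-- once, ∑ r² ≤ pL + L².  Hence ∑_q (p r(q) − L)² ≤ p³L, and Cauchy–Schwarz over P gives
-- (pI − Ln)² ≤ n p³ L for the incidence count I = ∑_{q ∈ P} r(q) ≥ |A|L.  Either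
-- pI ≤ 2Ln, giving p²|A| ≤ 4pn, or the deviation is at least pI/2, giving |A|²L ≤ 4pn.

open import Algebra.Bundles using (CommutativeSemiring)
open import Data.Nat using (ℕ; NonZero; suc)
open import Data.Nat.Primality using (Prime)
open import Data.Fin.Subset using (Subset)
open import Defs
import Data.Nat.Properties as ℕₚ
import Data.Integer.Properties as ℤₚ

module FiniteSum {c ℓ} (R : CommutativeSemiring c ℓ) where
  open import Data.List using (List; []; _∷_; _++_; map)
  open import Data.Product using (_×_; _,_; proj₁; proj₂)
  open CommutativeSemiring R
  open import Relation.Binary.Reasoning.Setoid setoid
  open import Algebra.Properties.CommutativeSemigroup +-commutativeSemigroup
    using (interchange)

  ∑ : {I : Set} → List I → (I → Carrier) → Carrier
  ∑ []       f = 0#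
  ∑ (x ∷ xs) f = f x + ∑ xs f

  module _ {I : Set} where

    ∑-zero : (xs : List I) → ∑ xs (λ _ → 0#) ≈ 0#
    ∑-zero []       = refl
    ∑-zero (x ∷ xs) = trans (+-congˡ (∑-zero xs)) (+-identityˡ 0#)

    ∑-cong : (xs : List I) {f g : I → Carrier} → (∀ x → f x ≈ g x) → ∑ xs f ≈ ∑ xs g
    ∑-cong []       f≈g = refl
    ∑-cong (x ∷ xs) f≈g = +-cong (f≈g x) (∑-cong xs f≈g)

    ∑-+ : (xs : List I) (f g : I → Carrier) → ∑ xs (λ x → f x + g x) ≈ ∑ xs f + ∑ xs g
    ∑-+ []       f g = sym (+-identityˡ 0#)
    ∑-+ (x ∷ xs) f g = begin
      f x + g x + ∑ xs (λ x → f x + g x) ≈⟨ +-congˡ (∑-+ xs f g) ⟩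
      f x + g x + (∑ xs f + ∑ xs g)       ≈⟨ interchange (f x) (g x) (∑ xs f) (∑ xs g) ⟩
      f x + ∑ xs f + (g x + ∑ xs g)       ∎

    ∑-*ˡ : (xs : List I) (a : Carrier) (f : I → Carrier) → ∑ xs (λ x → a * f x) ≈ a * ∑ xs f
    ∑-*ˡ []       a f = sym (zeroʳ a)
    ∑-*ˡ (x ∷ xs) a f = trans (+-congˡ (∑-*ˡ xs a f)) (sym (distribˡ a (f x) (∑ xs f)))

    ∑-*ʳ : (xs : List I) (a : Carrier) (f : I → Carrier) → ∑ xs (λ x → f x * a) ≈ ∑ xs f * a
    ∑-*ʳ xs a f = begin
      ∑ xs (λ x → f x * a) ≈⟨ ∑-cong xs (λ x → *-comm (f x) a) ⟩
      ∑ xs (λ x → a * f x) ≈⟨ ∑-*ˡ xs a f ⟩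
      a * ∑ xs f           ≈⟨ *-comm a (∑ xs f) ⟩
      ∑ xs f * a           ∎

    ∑-++ : (xs ys : List I) (f : I → Carrier) → ∑ (xs ++ ys) f ≈ ∑ xs f + ∑ ys f
    ∑-++ []       ys f = sym (+-identityˡ (∑ ys f))
    ∑-++ (x ∷ xs) ys f = trans (+-congˡ (∑-++ xs ys f)) (sym (+-assoc (f x) (∑ xs f) (∑ ys f)))

    ∑-linear₃ : (xs : List I) (a b d : Carrier) (f g h : I → Carrier) →
      ∑ xs (λ x → a * f x + (b * g x + d * h x)) ≈ a * ∑ xs f + (b * ∑ xs g + d * ∑ xs h)
    ∑-linear₃ xs a b d f g h = begin
      ∑ xs (λ x → a * f x + (b * g x + d * h x))
        ≈⟨ ∑-+ xs (λ x → a * f x) (λ x → b * g x + d * h x) ⟩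
      ∑ xs (λ x → a * f x) + ∑ xs (λ x → b * g x + d * h x)
        ≈⟨ +-cong (∑-*ˡ xs a f) (∑-+ xs (λ x → b * g x) (λ x → d * h x)) ⟩
      a * ∑ xs f + (∑ xs (λ x → b * g x) + ∑ xs (λ x → d * h x))
        ≈⟨ +-congˡ (+-cong (∑-*ˡ xs b g) (∑-*ˡ xs d h)) ⟩
      a * ∑ xs f + (b * ∑ xs g + d * ∑ xs h) ∎

  ∑-map : {I J : Set} (xs : List I) (h : I → J) (f : J → Carrier) → ∑ (map h xs) f ≈ ∑ xs (λ x → f (h x))
  ∑-map []       h f = refl
  ∑-map (x ∷ xs) h f = +-congˡ (∑-map xs h f)

  ∑-swap : {I J : Set} (xs : List I) (ys : List J) (f : I → J → Carrier) →
    ∑ xs (λ x → ∑ ys (f x)) ≈ ∑ ys (λ y → ∑ xs (λ x → f x y))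
  ∑-swap []       ys f = sym (∑-zero ys)
  ∑-swap (x ∷ xs) ys f = trans (+-congˡ (∑-swap xs ys f)) (sym (∑-+ ys (f x) (λ y → ∑ xs (λ x → f x y))))

  pairs : {I J : Set} → List I → List J → List (I × J)
  pairs []       ys = []
  pairs (x ∷ xs) ys = map (x ,_) ys ++ pairs xs ys

  ∑-pairs : {I J : Set} (xs : List I) (ys : List J) (f : I × J → Carrier) →
    ∑ (pairs xs ys) f ≈ ∑ xs (λ x → ∑ ys (λ y → f (x , y)))
  ∑-pairs []       ys f = refl
  ∑-pairs (x ∷ xs) ys f = begin
    ∑ (map (x ,_) ys ++ pairs xs ys) f      ≈⟨ ∑-++ (map (x ,_) ys) (pairs xs ys) f ⟩
    ∑ (map (x ,_) ys) f + ∑ (pairs xs ys) f ≈⟨ +-cong (∑-map ys (x ,_) f) (∑-pairs xs ys f) ⟩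
    ∑ ys (λ y → f (x , y)) + ∑ xs (λ x → ∑ ys (λ y → f (x , y))) ∎

  ∑-product : {I J : Set} (xs : List I) (ys : List J) (f : I → Carrier) (g : J → Carrier) →
    ∑ (pairs xs ys) (λ q → f (proj₁ q) * g (proj₂ q)) ≈ ∑ xs f * ∑ ys g
  ∑-product xs ys f g = begin
    ∑ (pairs xs ys) _                        ≈⟨ ∑-pairs xs ys _ ⟩
    ∑ xs (λ x → ∑ ys (λ y → f x * g y))      ≈⟨ ∑-cong xs (λ x → ∑-*ˡ ys (f x) g) ⟩
    ∑ xs (λ x → f x * ∑ ys g)                ≈⟨ ∑-*ʳ xs (∑ ys g) f ⟩
    ∑ xs f * ∑ ys g                          ∎

open FiniteSum ℕₚ.+-*-commutativeSemiring
module ℤSum = FiniteSum ℤₚ.+-*-commutativeSemiring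

module NaturalSums where
  open import Data.Nat using (zero; _+_; _*_; _≤_; z≤n)
  open import Data.Nat.Properties
  open import Data.Fin using (Fin; zero; suc)
  import Data.Fin.Properties as Finₚ
  open import Data.List using (List; []; _∷_; allFin; map; tabulate)
  open import Data.List.Properties using (map-tabulate)
  open import Data.Product using (∃; _,_)
  open import Data.Empty using (⊥-elim)
  open import Function using (_∘_; id)
  open import Relation.Nullary using (¬_; yes; no)
  open import Relation.Binary.PropositionalEquality

  ∑-mono : {I : Set} (xs : List I) {f g : I → ℕ} → (∀ x → f x ≤ g x) → ∑ xs f ≤ ∑ xs g
  ∑-mono []       f≤g = z≤n
  ∑-mono (x ∷ xs) f≤g = +-mono-≤ (f≤g x) (∑-mono xs f≤g)

  ∑-allFin-suc : ∀ {n} (f : Fin (suc n) → ℕ) → ∑ (allFin (suc n)) f ≡ f zero + ∑ (allFin n) (f ∘ suc)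
  ∑-allFin-suc {n} f = cong (f zero +_) (begin
    ∑ (tabulate suc) f          ≡⟨ cong (λ xs → ∑ xs f) (map-tabulate id suc) ⟨
    ∑ (map suc (allFin n)) f    ≡⟨ ∑-map (allFin n) suc f ⟩
    ∑ (allFin n) (f ∘ suc)      ∎)
    where open ≡-Reasoning

  ∑-allFin-const : ∀ n c → ∑ (allFin n) (λ _ → c) ≡ n * c
  ∑-allFin-const zero    c = refl
  ∑-allFin-const (suc n) c = trans (∑-allFin-suc {n} (λ _ → c)) (cong (c +_) (∑-allFin-const n c))

  ∑-witness : {I : Set} (xs : List I) (f : I → ℕ) → ¬ ∑ xs f ≡ 0 → ∃ λ x → ¬ f x ≡ 0
  ∑-witness []       f ∑≢0 = ⊥-elim (∑≢0 refl)
  ∑-witness (x ∷ xs) f ∑≢0 with f x ≟ 0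
  ... | yes fx≡0 = ∑-witness xs f (λ ∑≡0 → ∑≢0 (trans (cong (_+ ∑ xs f) fx≡0) ∑≡0))
  ... | no  fx≢0 = x , fx≢0

  ∑-≤1 : ∀ {n} (f : Fin n → ℕ) → (∀ x → f x ≤ 1) →
    (∀ x y → ¬ f x ≡ 0 → ¬ f y ≡ 0 → x ≡ y) → ∑ (allFin n) f ≤ 1
  ∑-≤1 {zero}  f f≤1 unique = z≤n
  ∑-≤1 {suc n} f f≤1 unique rewrite ∑-allFin-suc f with f zero ≟ 0
  ... | yes f0≡0 rewrite f0≡0 =
    ∑-≤1 (f ∘ suc) (f≤1 ∘ suc) (λ x y fx≢0 fy≢0 → Finₚ.suc-injective (unique (suc x) (suc y) fx≢0 fy≢0))
  ... | no  f0≢0 = subst (λ s → f zero + s ≤ 1) (sym rest≡0)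
                     (subst (_≤ 1) (sym (+-identityʳ (f zero))) (f≤1 zero))
    where
    vanishes : ∀ x → f (suc x) ≡ 0
    vanishes x with f (suc x) ≟ 0
    ... | yes fx≡0 = fx≡0
    ... | no  fx≢0 with unique zero (suc x) f0≢0 fx≢0
    ...   | ()
    rest≡0 : ∑ (allFin n) (f ∘ suc) ≡ 0
    rest≡0 = trans (∑-cong (allFin n) vanishes) (∑-zero (allFin n))

  *-monoʳ-≤-where-nonzero : ∀ u {M B} → (¬ u ≡ 0 → M ≤ B) → u * M ≤ u * B
  *-monoʳ-≤-where-nonzero zero    M≤B = z≤n
  *-monoʳ-≤-where-nonzero (suc u) M≤B = *-monoʳ-≤ (suc u) (M≤B (λ ()))

  weighted-≤ : ∀ u v {M B} → (¬ u ≡ 0 → ¬ v ≡ 0 → M ≤ B) → u * (v * M) ≤ u * (v * B)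
  weighted-≤ u v M≤B = *-monoʳ-≤-where-nonzero u (λ u≢0 → *-monoʳ-≤-where-nonzero v (M≤B u≢0))

open NaturalSums

-- The Kronecker delta of a type with decidable equality.  A list enumerates the type
-- when summing against δ t picks out the value at t, i.e. it lists every element once.
module KroneckerDelta where
  open import Data.Nat using (_+_; _*_; _≤_; z≤n; s≤s)
  open import Data.Nat.Properties using (+-identityʳ; *-identityˡ; *-assoc)
  open import Data.Bool using (true; false; if_then_else_)
  open import Data.Fin using (zero; suc)
  import Data.Fin.Properties as Finₚ
  open import Data.List using (List; allFin)
  open import Data.Product using (_,_)
  open import Data.Product.Properties using (≡-dec)
  open import Data.Empty using (⊥-elim)
  open import Function using (_∘_)
  open import Relation.Nullary using (¬_; yes; no; does)
  open import Relation.Binary.Definitions using (DecidableEquality)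
  open import Relation.Binary.PropositionalEquality

  module Delta {A : Set} (_≟_ : DecidableEquality A) where

    δ : A → A → ℕ
    δ x y = if does (x ≟ y) then 1 else 0

    δ-refl : (x : A) → δ x x ≡ 1
    δ-refl x with x ≟ x
    ... | yes _  = refl
    ... | no x≢x = ⊥-elim (x≢x refl)

    δ≤1 : (x y : A) → δ x y ≤ 1
    δ≤1 x y with does (x ≟ y)
    ... | true  = s≤s z≤n
    ... | false = z≤n

    δ≢0⇒≡ : (x y : A) → ¬ δ x y ≡ 0 → x ≡ y
    δ≢0⇒≡ x y δ≢0 with x ≟ y
    ... | yes x≡y = x≡y
    ... | no  _   = ⊥-elim (δ≢0 refl)

    Enumerates : List A → Set
    Enumerates xs = (t : A) (g : A → ℕ) → ∑ xs (λ x → δ t x * g x) ≡ g t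

  open Delta using (Enumerates) public

  allFin-enumerates : ∀ n → Enumerates Finₚ._≟_ (allFin n)
  allFin-enumerates (suc n) zero g = begin
    ∑ (allFin (suc n)) (λ x → δ zero x * g x)  ≡⟨ ∑-allFin-suc (λ x → δ zero x * g x) ⟩
    1 * g zero + ∑ (allFin n) (λ _ → 0)        ≡⟨ cong₂ _+_ (*-identityˡ (g zero)) (∑-zero (allFin n)) ⟩
    g zero + 0                                  ≡⟨ +-identityʳ (g zero) ⟩
    g zero                                      ∎
    where open ≡-Reasoning
          open Delta Finₚ._≟_
  allFin-enumerates (suc n) (suc t) g =
    trans (∑-allFin-suc (λ x → δ (suc t) x * g x)) (allFin-enumerates n t (g ∘ suc))
    where open Delta Finₚ._≟_

  module _ {A B : Set} (_≟A_ : DecidableEquality A) (_≟B_ : DecidableEquality B) where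
    private
      module DA = Delta _≟A_
      module DB = Delta _≟B_
      module DP = Delta (≡-dec _≟A_ _≟B_)

    δ-pair : (a c : A) (b d : B) → DP.δ (a , b) (c , d) ≡ DA.δ a c * DB.δ b d
    δ-pair a c b d with a ≟A c
    ... | no _     = refl
    ... | yes refl with b ≟B d
    ...   | yes _ = refl
    ...   | no _  = refl

    pairs-enumerates : (xs : List A) (ys : List B) →
      Enumerates _≟A_ xs → Enumerates _≟B_ ys → Enumerates (≡-dec _≟A_ _≟B_) (pairs xs ys)
    pairs-enumerates xs ys enum-xs enum-ys (a , b) g = begin
      ∑ (pairs xs ys) (λ q → DP.δ (a , b) q * g q)
        ≡⟨ ∑-pairs xs ys _ ⟩
      ∑ xs (λ x → ∑ ys (λ y → DP.δ (a , b) (x , y) * g (x , y)))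
        ≡⟨ ∑-cong xs (λ x → ∑-cong ys (λ y → cong (_* g (x , y)) (δ-pair a x b y))) ⟩
      ∑ xs (λ x → ∑ ys (λ y → DA.δ a x * DB.δ b y * g (x , y)))
        ≡⟨ ∑-cong xs (λ x → ∑-cong ys (λ y → *-assoc (DA.δ a x) (DB.δ b y) (g (x , y)))) ⟩
      ∑ xs (λ x → ∑ ys (λ y → DA.δ a x * (DB.δ b y * g (x , y))))
        ≡⟨ ∑-cong xs (λ x → trans (∑-*ˡ ys (DA.δ a x) _) (cong (DA.δ a x *_) (enum-ys b (λ y → g (x , y))))) ⟩
      ∑ xs (λ x → DA.δ a x * g (x , b))
        ≡⟨ enum-xs a (λ x → g (x , b)) ⟩
      g (a , b) ∎
      where open ≡-Reasoning

open KroneckerDelta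

module CauchySchwarz where
  open import Data.Nat using (zero; _+_; _*_; _≤_; z≤n)
  open import Data.Nat.Properties using (*-cancelˡ-≤; m+n≡0⇒m≡0; m+n≡0⇒n≡0; m≤n+m)
  open import Data.Integer as ℤ using (ℤ; +_; ∣_∣)
  open import Data.Integer.Tactic.RingSolver using (solve-∀)
  open import Data.List using (List; []; _∷_)
  open import Relation.Binary.PropositionalEquality
  open ℤSum using () renaming (∑ to ℤ∑)

  ∑-cast : {I : Set} (xs : List I) (f : I → ℕ) → + ∑ xs f ≡ ℤ∑ xs (λ x → + f x)
  ∑-cast []       f = refl
  ∑-cast (x ∷ xs) f = trans (ℤₚ.pos-+ (f x) (∑ xs f)) (cong (λ z → + f x ℤ.+ z) (∑-cast xs f))

  square : (x : ℤ) → x ℤ.* x ≡ + (∣ x ∣ * ∣ x ∣)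
  square (+ n)      = sym (ℤₚ.pos-* n n)
  square ℤ.-[1+ n ] = refl

  +-identity⇒ℕ : ∀ a b c → + a ≡ + b ℤ.+ + c → a ≡ b + c
  +-identity⇒ℕ a b c eq = ℤₚ.+-injective (trans eq (sym (ℤₚ.pos-+ b c)))

  *-cancelˡ-≤-unless-zero : ∀ n {a b} → (n ≡ 0 → a ≡ 0) → n * a ≤ n * b → a ≤ b
  *-cancelˡ-≤-unless-zero zero    a≡0 _ rewrite a≡0 refl = z≤n
  *-cancelˡ-≤-unless-zero (suc n) _   le = *-cancelˡ-≤ (suc n) le

  weighted-∑-vanishes : {I : Set} (xs : List I) (w : I → ℕ) (x : I → ℤ) →
    ∑ xs w ≡ 0 → ℤ∑ xs (λ i → + w i ℤ.* x i) ≡ + 0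
  weighted-∑-vanishes []       w x _    = refl
  weighted-∑-vanishes (i ∷ xs) w x ∑≡0 =
    cong₂ (λ a b → + a ℤ.* x i ℤ.+ b) (m+n≡0⇒m≡0 (w i) ∑≡0) (weighted-∑-vanishes xs w x (m+n≡0⇒n≡0 (w i) ∑≡0))

  module _ {I : Set} (xs : List I) (w : I → ℕ) (x : I → ℤ) where
    private
      n U : ℕ
      n = ∑ xs w
      U = ∑ xs (λ i → w i * (∣ x i ∣ * ∣ x i ∣))
      s : ℤ
      s = ℤ∑ xs (λ i → + w i ℤ.* x i)
      y : I → ℤ
      y i = + n ℤ.* x i ℤ.- s
      K : ℕ
      K = ∑ xs (λ i → w i * (∣ y i ∣ * ∣ y i ∣))

      cast-weighted-square : (v : I → ℤ) →
        + ∑ xs (λ i → w i * (∣ v i ∣ * ∣ v i ∣)) ≡ ℤ∑ xs (λ i → + w i ℤ.* (v i ℤ.* v i))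
      cast-weighted-square v = trans (∑-cast xs _) (ℤSum.∑-cong xs (λ i →
        trans (ℤₚ.pos-* (w i) _) (cong (λ z → + w i ℤ.* z) (sym (square (v i))))))

      expand : ∀ n s w x → w ℤ.* ((n ℤ.* x ℤ.- s) ℤ.* (n ℤ.* x ℤ.- s))
             ≡ n ℤ.* n ℤ.* (w ℤ.* (x ℤ.* x)) ℤ.+ ((ℤ.- (+ 2) ℤ.* n ℤ.* s) ℤ.* (w ℤ.* x) ℤ.+ s ℤ.* s ℤ.* w)
      expand = solve-∀

      collect : ∀ n s u → n ℤ.* n ℤ.* u ℤ.+ ((ℤ.- (+ 2) ℤ.* n ℤ.* s) ℤ.* s ℤ.+ s ℤ.* s ℤ.* n) ℤ.+ n ℤ.* (s ℤ.* s)
              ≡ n ℤ.* (n ℤ.* u)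
      collect = solve-∀

    deviation-expansion : + K ℤ.+ + n ℤ.* (s ℤ.* s) ≡ + n ℤ.* (+ n ℤ.* + U)
    deviation-expansion = begin
      + K ℤ.+ + n ℤ.* (s ℤ.* s)
        ≡⟨ cong (ℤ._+ + n ℤ.* (s ℤ.* s)) (trans (cast-weighted-square y) (ℤSum.∑-cong xs (λ i → expand (+ n) s (+ w i) (x i)))) ⟩
      ℤ∑ xs (λ i → + n ℤ.* + n ℤ.* (+ w i ℤ.* (x i ℤ.* x i)) ℤ.+ ((ℤ.- (+ 2) ℤ.* + n ℤ.* s) ℤ.* (+ w i ℤ.* x i) ℤ.+ s ℤ.* s ℤ.* + w i))
        ℤ.+ + n ℤ.* (s ℤ.* s)
        ≡⟨ cong (ℤ._+ + n ℤ.* (s ℤ.* s)) (ℤSum.∑-linear₃ xs (+ n ℤ.* + n) (ℤ.- (+ 2) ℤ.* + n ℤ.* s) (s ℤ.* s)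
             (λ i → + w i ℤ.* (x i ℤ.* x i)) (λ i → + w i ℤ.* x i) (λ i → + w i)) ⟩
      + n ℤ.* + n ℤ.* ℤ∑ xs (λ i → + w i ℤ.* (x i ℤ.* x i)) ℤ.+ ((ℤ.- (+ 2) ℤ.* + n ℤ.* s) ℤ.* s ℤ.+ s ℤ.* s ℤ.* ℤ∑ xs (λ i → + w i))
        ℤ.+ + n ℤ.* (s ℤ.* s)
        ≡⟨ cong₂ (λ u m → + n ℤ.* + n ℤ.* u ℤ.+ ((ℤ.- (+ 2) ℤ.* + n ℤ.* s) ℤ.* s ℤ.+ s ℤ.* s ℤ.* m) ℤ.+ + n ℤ.* (s ℤ.* s))
           (sym (cast-weighted-square x)) (sym (∑-cast xs w)) ⟩
      + n ℤ.* + n ℤ.* + U ℤ.+ ((ℤ.- (+ 2) ℤ.* + n ℤ.* s) ℤ.* s ℤ.+ s ℤ.* s ℤ.* + n) ℤ.+ + n ℤ.* (s ℤ.* s)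
        ≡⟨ collect (+ n) s (+ U) ⟩
      + n ℤ.* (+ n ℤ.* + U) ∎
      where open ≡-Reasoning

    deviation-expansion-ℕ : n * (n * U) ≡ K + n * (∣ s ∣ * ∣ s ∣)
    deviation-expansion-ℕ = +-identity⇒ℕ _ K _ (begin
      + (n * (n * U))                   ≡⟨ trans (ℤₚ.pos-* n _) (cong (λ z → + n ℤ.* z) (ℤₚ.pos-* n U)) ⟩
      + n ℤ.* (+ n ℤ.* + U)             ≡⟨ deviation-expansion ⟨
      + K ℤ.+ + n ℤ.* (s ℤ.* s)         ≡⟨ cong (λ z → + K ℤ.+ + n ℤ.* z) (square s) ⟩
      + K ℤ.+ + n ℤ.* + (∣ s ∣ * ∣ s ∣) ≡⟨ cong (λ z → + K ℤ.+ z) (sym (ℤₚ.pos-* n _)) ⟩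
      + K ℤ.+ + (n * (∣ s ∣ * ∣ s ∣))   ∎)
      where open ≡-Reasoning

    -- Cauchy–Schwarz with nonnegative weights: (∑ wᵢxᵢ)² ≤ (∑ wᵢ)(∑ wᵢxᵢ²), since
    -- n·(n·U − s²) = K ≥ 0; when n = 0 all weights vanish and so does s.
    cauchy-schwarz : ∣ ℤ∑ xs (λ i → + w i ℤ.* x i) ∣ * ∣ ℤ∑ xs (λ i → + w i ℤ.* x i) ∣
                   ≤ ∑ xs w * ∑ xs (λ i → w i * (∣ x i ∣ * ∣ x i ∣))
    cauchy-schwarz =
      *-cancelˡ-≤-unless-zero n (λ n≡0 → cong (λ z → ∣ z ∣ * ∣ z ∣) (weighted-∑-vanishes xs w x n≡0))
        (subst (n * (∣ s ∣ * ∣ s ∣) ≤_) (sym deviation-expansion-ℕ) (m≤n+m _ K))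

open CauchySchwarz

module SecondMomentBound where
  open import Data.Nat using (zero; _+_; _*_; _∸_; _≤_; _⊓_; z≤n)
  open import Data.Nat.Properties
  open import Data.Integer as ℤ using (ℤ; +_; ∣_∣)
  open import Data.Integer.Tactic.RingSolver using (solve-∀)
  import Data.Nat.Tactic.RingSolver as ℕSolver
  open import Data.List using (List; []; _∷_)
  open import Relation.Binary.PropositionalEquality
  open import Relation.Nullary using (yes; no)
  open ℤSum using () renaming (∑ to ℤ∑)

  cong₃ : {A B C D : Set} (f : A → B → C → D) {a a′ : A} {b b′ : B} {c c′ : C} →
          a ≡ a′ → b ≡ b′ → c ≡ c′ → f a b c ≡ f a′ b′ c′
  cong₃ f refl refl refl = refl

  module SecondMoment {I : Set} (Q : List I) (r w : I → ℕ) (p L : ℕ)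
    (size : ∑ Q (λ _ → 1) ≡ p * p) (mass : ∑ Q r ≡ p * L)
    (energy : ∑ Q (λ q → r q * r q) ≤ p * L + L * L) (w≤1 : ∀ q → w q ≤ 1) where

    n : ℕ
    n = ∑ Q w
    incidences : ℕ
    incidences = ∑ Q (λ q → w q * r q)

    -- p·r − L is the deviation of r from its mean L/p, scaled by p.
    D : I → ℤ
    D q = + p ℤ.* + r q ℤ.- + L

    sqD : I → ℕ
    sqD q = ∣ D q ∣ * ∣ D q ∣

    square-deviation : ∀ q → + sqD q ≡
      + p ℤ.* + p ℤ.* + (r q * r q) ℤ.+ (ℤ.- (+ 2) ℤ.* + p ℤ.* + L ℤ.* + r q ℤ.+ + L ℤ.* + L ℤ.* + 1)
    square-deviation q = begin
      + sqD q       ≡⟨ square (D q) ⟨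
      D q ℤ.* D q   ≡⟨ expand (+ p) (+ L) (+ r q) ⟩
      + p ℤ.* + p ℤ.* (+ r q ℤ.* + r q) ℤ.+ (ℤ.- (+ 2) ℤ.* + p ℤ.* + L ℤ.* + r q ℤ.+ + L ℤ.* + L ℤ.* + 1)
        ≡⟨ cong (λ z → + p ℤ.* + p ℤ.* z ℤ.+ (ℤ.- (+ 2) ℤ.* + p ℤ.* + L ℤ.* + r q ℤ.+ + L ℤ.* + L ℤ.* + 1))
                (ℤₚ.pos-* (r q) (r q)) ⟨
      + p ℤ.* + p ℤ.* + (r q * r q) ℤ.+ (ℤ.- (+ 2) ℤ.* + p ℤ.* + L ℤ.* + r q ℤ.+ + L ℤ.* + L ℤ.* + 1) ∎
      where
      open ≡-Reasoning
      expand : ∀ P L r → (P ℤ.* r ℤ.- L) ℤ.* (P ℤ.* r ℤ.- L)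
             ≡ P ℤ.* P ℤ.* (r ℤ.* r) ℤ.+ (ℤ.- (+ 2) ℤ.* P ℤ.* L ℤ.* r ℤ.+ L ℤ.* L ℤ.* + 1)
      expand = solve-∀

    ∑-square-deviations : + ∑ Q sqD ≡
      + p ℤ.* + p ℤ.* + ∑ Q (λ q → r q * r q) ℤ.+ (ℤ.- (+ 2) ℤ.* + p ℤ.* + L ℤ.* + (p * L) ℤ.+ + L ℤ.* + L ℤ.* + (p * p))
    ∑-square-deviations = begin
      + ∑ Q sqD
        ≡⟨ trans (∑-cast Q sqD) (ℤSum.∑-cong Q square-deviation) ⟩
      ℤ∑ Q (λ q → + p ℤ.* + p ℤ.* + (r q * r q) ℤ.+ (ℤ.- (+ 2) ℤ.* + p ℤ.* + L ℤ.* + r q ℤ.+ + L ℤ.* + L ℤ.* + 1))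
        ≡⟨ ℤSum.∑-linear₃ Q (+ p ℤ.* + p) (ℤ.- (+ 2) ℤ.* + p ℤ.* + L) (+ L ℤ.* + L) (λ q → + (r q * r q)) (λ q → + r q) (λ _ → + 1) ⟩
      + p ℤ.* + p ℤ.* ℤ∑ Q (λ q → + (r q * r q)) ℤ.+ (ℤ.- (+ 2) ℤ.* + p ℤ.* + L ℤ.* ℤ∑ Q (λ q → + r q) ℤ.+ + L ℤ.* + L ℤ.* ℤ∑ Q (λ _ → + 1))
        ≡⟨ cong₃ (λ a b c → + p ℤ.* + p ℤ.* a ℤ.+ (ℤ.- (+ 2) ℤ.* + p ℤ.* + L ℤ.* b ℤ.+ + L ℤ.* + L ℤ.* c))
             (sym (∑-cast Q _)) (trans (sym (∑-cast Q r)) (cong +_ mass)) (trans (sym (∑-cast Q _)) (cong +_ size)) ⟩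
      + p ℤ.* + p ℤ.* + ∑ Q (λ q → r q * r q) ℤ.+ (ℤ.- (+ 2) ℤ.* + p ℤ.* + L ℤ.* + (p * L) ℤ.+ + L ℤ.* + L ℤ.* + (p * p)) ∎
      where open ≡-Reasoning

    variance : ∑ Q sqD + p * p * (L * L) ≡ p * p * ∑ Q (λ q → r q * r q)
    variance = sym (+-identity⇒ℕ (p * p * T) (∑ Q sqD) (p * p * (L * L)) (begin
      + (p * p * T)
        ≡⟨ casts ⟩
      + p ℤ.* + p ℤ.* + T
        ≡⟨ collect (+ p) (+ L) (+ T) ⟩
      + p ℤ.* + p ℤ.* + T ℤ.+ (ℤ.- (+ 2) ℤ.* + p ℤ.* + L ℤ.* (+ p ℤ.* + L) ℤ.+ + L ℤ.* + L ℤ.* (+ p ℤ.* + p))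
        ℤ.+ + p ℤ.* + p ℤ.* (+ L ℤ.* + L)
        ≡⟨ cong₂ ℤ._+_ (trans (cong₂ (λ a b → + p ℤ.* + p ℤ.* + T ℤ.+ (ℤ.- (+ 2) ℤ.* + p ℤ.* + L ℤ.* a ℤ.+ + L ℤ.* + L ℤ.* b))
                                     (sym (ℤₚ.pos-* p L)) (sym (ℤₚ.pos-* p p))) (sym ∑-square-deviations))
                       (sym casts′) ⟩
      + ∑ Q sqD ℤ.+ + (p * p * (L * L)) ∎))
      where
      open ≡-Reasoning
      T : ℕ
      T = ∑ Q (λ q → r q * r q)
      casts : + (p * p * T) ≡ + p ℤ.* + p ℤ.* + T
      casts = trans (ℤₚ.pos-* (p * p) T) (cong (ℤ._* + T) (ℤₚ.pos-* p p))
      casts′ : + (p * p * (L * L)) ≡ + p ℤ.* + p ℤ.* (+ L ℤ.* + L)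
      casts′ = trans (ℤₚ.pos-* (p * p) (L * L)) (cong₂ ℤ._*_ (ℤₚ.pos-* p p) (ℤₚ.pos-* L L))
      collect : ∀ P L T → P ℤ.* P ℤ.* T
              ≡ P ℤ.* P ℤ.* T ℤ.+ (ℤ.- (+ 2) ℤ.* P ℤ.* L ℤ.* (P ℤ.* L) ℤ.+ L ℤ.* L ℤ.* (P ℤ.* P)) ℤ.+ P ℤ.* P ℤ.* (L ℤ.* L)
      collect = solve-∀

    variance-bound : ∑ Q sqD ≤ p * p * p * L
    variance-bound = +-cancelʳ-≤ (p * p * (L * L)) (∑ Q sqD) (p * p * p * L) (begin
      ∑ Q sqD + p * p * (L * L)             ≡⟨ variance ⟩
      p * p * ∑ Q (λ q → r q * r q)         ≤⟨ *-monoʳ-≤ (p * p) energy ⟩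
      p * p * (p * L + L * L)               ≡⟨ expand p L ⟩
      p * p * p * L + p * p * (L * L)       ∎)
      where
      open ≤-Reasoning
      expand : ∀ p L → p * p * (p * L + L * L) ≡ p * p * p * L + p * p * (L * L)
      expand = ℕSolver.solve-∀

    weighted-deviation : ℤ∑ Q (λ q → + w q ℤ.* D q) ≡ + (p * incidences) ℤ.- + (L * n)
    weighted-deviation = begin
      ℤ∑ Q (λ q → + w q ℤ.* D q)
        ≡⟨ ℤSum.∑-cong Q pointwise ⟩
      ℤ∑ Q (λ q → + p ℤ.* + (w q * r q) ℤ.+ ℤ.- + L ℤ.* + w q)
        ≡⟨ ℤSum.∑-+ Q _ _ ⟩
      ℤ∑ Q (λ q → + p ℤ.* + (w q * r q)) ℤ.+ ℤ∑ Q (λ q → ℤ.- + L ℤ.* + w q)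
        ≡⟨ cong₂ ℤ._+_ (ℤSum.∑-*ˡ Q (+ p) _) (ℤSum.∑-*ˡ Q (ℤ.- + L) _) ⟩
      + p ℤ.* ℤ∑ Q (λ q → + (w q * r q)) ℤ.+ ℤ.- + L ℤ.* ℤ∑ Q (λ q → + w q)
        ≡⟨ cong₂ (λ a b → + p ℤ.* a ℤ.+ ℤ.- + L ℤ.* b) (sym (∑-cast Q _)) (sym (∑-cast Q w)) ⟩
      + p ℤ.* + incidences ℤ.+ ℤ.- + L ℤ.* + n
        ≡⟨ regroup (+ p) (+ incidences) (+ L) (+ n) ⟩
      + p ℤ.* + incidences ℤ.- + L ℤ.* + n
        ≡⟨ sym (cong₂ ℤ._-_ (ℤₚ.pos-* p incidences) (ℤₚ.pos-* L n)) ⟩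
      + (p * incidences) ℤ.- + (L * n) ∎
      where
      open ≡-Reasoning
      distribute : ∀ p L w r → w ℤ.* (p ℤ.* r ℤ.- L) ≡ p ℤ.* (w ℤ.* r) ℤ.+ ℤ.- L ℤ.* w
      distribute = solve-∀
      regroup : ∀ p i L n → p ℤ.* i ℤ.+ ℤ.- L ℤ.* n ≡ p ℤ.* i ℤ.- L ℤ.* n
      regroup = solve-∀
      pointwise : ∀ q → + w q ℤ.* D q ≡ + p ℤ.* + (w q * r q) ℤ.+ ℤ.- + L ℤ.* + w q
      pointwise q = trans (distribute (+ p) (+ L) (+ w q) (+ r q))
        (cong (λ z → + p ℤ.* z ℤ.+ ℤ.- + L ℤ.* + w q) (sym (ℤₚ.pos-* (w q) (r q))))

    -- Cauchy–Schwarz against the weights w, with the variance bound, controls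
    -- how far the incidence count can exceed its expected value L·n / p.
    deviation-bound : L * n ≤ p * incidences →
      (p * incidences ∸ L * n) * (p * incidences ∸ L * n) ≤ n * (p * p * p * L)
    deviation-bound Ln≤pI = begin
      (p * incidences ∸ L * n) * (p * incidences ∸ L * n)
                                    ≡⟨ cong (λ z → z * z) ∣s∣ ⟨
      ∣ s ∣ * ∣ s ∣                 ≡⟨ cong (λ z → ∣ z ∣ * ∣ z ∣) weighted-deviation ⟨
      ∣ s′ ∣ * ∣ s′ ∣               ≤⟨ cauchy-schwarz Q w D ⟩
      n * ∑ Q (λ q → w q * sqD q)   ≤⟨ *-monoʳ-≤ n (∑-mono Q (λ q → drop-weight (w q) (w≤1 q))) ⟩
      n * ∑ Q sqD                   ≤⟨ *-monoʳ-≤ n variance-bound ⟩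
      n * (p * p * p * L)           ∎
      where
      open ≤-Reasoning
      s s′ : ℤ
      s = + (p * incidences) ℤ.- + (L * n)
      s′ = ℤ∑ Q (λ q → + w q ℤ.* D q)
      ∣s∣ : ∣ s ∣ ≡ p * incidences ∸ L * n
      ∣s∣ = cong ∣_∣ (trans (ℤₚ.m-n≡m⊖n (p * incidences) (L * n)) (ℤₚ.⊖-≥ Ln≤pI))
      drop-weight : ∀ {x} v → v ≤ 1 → v * x ≤ x
      drop-weight {x} v v≤1 = ≤-trans (*-monoˡ-≤ x v≤1) (≤-reflexive (*-identityˡ x))

  ≤-double-∸ : ∀ x y → 2 * y ≤ x → x ≤ 2 * (x ∸ y)
  ≤-double-∸ x y 2y≤x = begin
    x                   ≡⟨ m∸n+n≡m y≤x ⟨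
    (x ∸ y) + y         ≤⟨ +-monoʳ-≤ (x ∸ y) y≤x∸y ⟩
    (x ∸ y) + (x ∸ y)   ≡⟨ cong (λ z → (x ∸ y) + z) (+-identityʳ (x ∸ y)) ⟨
    2 * (x ∸ y)         ∎
    where
    open ≤-Reasoning
    y+y≤x : y + y ≤ x
    y+y≤x = subst (_≤ x) (cong (λ z → y + z) (+-identityʳ y)) 2y≤x
    y≤x∸y : y ≤ x ∸ y
    y≤x∸y = m+n≤o⇒m≤o∸n y y+y≤x
    y≤x : y ≤ x
    y≤x = m+n≤o⇒m≤o y y+y≤x

  few-incidences : ∀ p L a n I .{{_ : NonZero L}} →
    a * L ≤ I → p * I ≤ 2 * (L * n) → p * p * a ≤ 4 * p * n
  few-incidences p L a n I aL≤I pI≤2Ln = begin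
    p * p * a       ≡⟨ *-assoc p p a ⟩
    p * (p * a)     ≤⟨ *-monoʳ-≤ p pa≤2n ⟩
    p * (2 * n)     ≤⟨ *-monoʳ-≤ p (*-monoˡ-≤ n (m≤m+n 2 2)) ⟩
    p * (4 * n)     ≡⟨ ℕSolver.solve (p ∷ n ∷ []) ⟩
    4 * p * n       ∎
    where
    open ≤-Reasoning
    pa≤2n : p * a ≤ 2 * n
    pa≤2n = *-cancelʳ-≤ (p * a) (2 * n) L (begin
      p * a * L     ≡⟨ *-assoc p a L ⟩
      p * (a * L)   ≤⟨ *-monoʳ-≤ p aL≤I ⟩
      p * I         ≤⟨ pI≤2Ln ⟩
      2 * (L * n)   ≡⟨ ℕSolver.solve (L ∷ n ∷ []) ⟩
      2 * n * L     ∎)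

  -- Many incidences (2Ln ≤ p·I): the deviation bound forces I² ≤ 4pnL, whence a²L ≤ 4pn.
  many-incidences : ∀ p L a n I .{{_ : NonZero p}} .{{_ : NonZero L}} →
    a * L ≤ I → 2 * (L * n) ≤ p * I →
    (p * I ∸ L * n) * (p * I ∸ L * n) ≤ n * (p * p * p * L) →
    a * a * L ≤ 4 * p * n
  many-incidences p L a n I aL≤I 2Ln≤pI deviation = *-cancelʳ-≤ (a * a * L) (4 * p * n) L (begin
    a * a * L * L       ≡⟨ ℕSolver.solve (a ∷ L ∷ []) ⟩
    (a * L) * (a * L)   ≤⟨ *-mono-≤ aL≤I aL≤I ⟩
    I * I               ≤⟨ *-cancelˡ-≤ (p * p) {{m*n≢0 p p}} p²I²≤p²4pnL ⟩
    4 * p * n * L       ∎)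
    where
    open ≤-Reasoning
    s : ℕ
    s = p * I ∸ L * n
    p²I²≤p²4pnL : p * p * (I * I) ≤ p * p * (4 * p * n * L)
    p²I²≤p²4pnL = begin
      p * p * (I * I)       ≡⟨ ℕSolver.solve (p ∷ I ∷ []) ⟩
      (p * I) * (p * I)     ≤⟨ *-mono-≤ (≤-double-∸ (p * I) (L * n) 2Ln≤pI) (≤-double-∸ (p * I) (L * n) 2Ln≤pI) ⟩
      (2 * s) * (2 * s)     ≡⟨ double-square s ⟩
      4 * (s * s)           ≤⟨ *-monoʳ-≤ 4 deviation ⟩
      4 * (n * (p * p * p * L)) ≡⟨ ℕSolver.solve (n ∷ p ∷ L ∷ []) ⟩
      p * p * (4 * p * n * L) ∎
      where
      double-square : ∀ s → (2 * s) * (2 * s) ≡ 4 * (s * s)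
      double-square = ℕSolver.solve-∀

  min-bound : ∀ p L a n I .{{_ : NonZero p}} →
    a * L ≤ I →
    (L * n ≤ p * I → (p * I ∸ L * n) * (p * I ∸ L * n) ≤ n * (p * p * p * L)) →
    (p * p * a) ⊓ (a * a * L) ≤ 4 * p * n
  min-bound p zero a n I _ _ =
    ≤-trans (m⊓n≤n (p * p * a) (a * a * 0)) (≤-trans (≤-reflexive (*-zeroʳ (a * a))) z≤n)
  min-bound p L@(suc _) a n I aL≤I deviation with p * I ≤? 2 * (L * n)
  ... | yes pI≤2Ln = ≤-trans (m⊓n≤m _ _) (few-incidences p L a n I aL≤I pI≤2Ln)
  ... | no  pI≰2Ln = ≤-trans (m⊓n≤n _ _)
          (many-incidences p L a n I aL≤I 2Ln≤pI (deviation (≤-trans (m≤m+n (L * n) _) 2Ln≤pI)))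
    where
    2Ln≤pI : 2 * (L * n) ≤ p * I
    2Ln≤pI = <⇒≤ (≰⇒> pI≰2Ln)

open SecondMomentBound

module Incidences where
  open import Data.Nat using (zero; _+_; _*_; _≤_; z≤n; s≤s)
  open import Data.Nat.Properties
  open import Data.Fin using (Fin)
  open import Data.List using (List; allFin)
  open import Data.Product using (∃; _,_)
  open import Relation.Nullary using (¬_)
  open import Relation.Binary.Definitions using (DecidableEquality)
  open import Relation.Binary.PropositionalEquality
  import Data.Nat.Tactic.RingSolver as ℕSolver

  -- A weighted family of curves: curve i (weight W i) is the map a ↦ t i a from the
  -- parameters Fin m into the points.  r q counts the weighted incidences at the point q.
  module CurveFamily {I Q : Set} (_≟I_ : DecidableEquality I) (_≟Q_ : DecidableEquality Q)
    (curves : List I) (points : List Q)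
    (curves-enum : Enumerates _≟I_ curves) (points-enum : Enumerates _≟Q_ points)
    (m : ℕ) (t : I → Fin m → Q) (W : I → ℕ) where

    open Delta _≟Q_
    open Delta _≟I_ using () renaming (δ to δI)

    params : List (Fin m)
    params = allFin m

    hits : I → Q → ℕ
    hits i q = ∑ params (λ a → δ (t i a) q)

    r : Q → ℕ
    r q = ∑ curves (λ i → W i * hits i q)

    meet : I → I → ℕ
    meet i j = ∑ params (λ a → hits j (t i a))

    ∑-against-hits : ∀ i (g : Q → ℕ) → ∑ points (λ q → g q * hits i q) ≡ ∑ params (λ a → g (t i a))
    ∑-against-hits i g = begin
      ∑ points (λ q → g q * hits i q)                          ≡⟨ ∑-cong points (λ q → ∑-*ˡ params (g q) _) ⟨
      ∑ points (λ q → ∑ params (λ a → g q * δ (t i a) q))      ≡⟨ ∑-swap points params _ ⟩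
      ∑ params (λ a → ∑ points (λ q → g q * δ (t i a) q))      ≡⟨ ∑-cong params (λ a → ∑-cong points (λ q → *-comm (g q) _)) ⟩
      ∑ params (λ a → ∑ points (λ q → δ (t i a) q * g q))      ≡⟨ ∑-cong params (λ a → points-enum (t i a) g) ⟩
      ∑ params (λ a → g (t i a))                               ∎
      where open ≡-Reasoning

    ∑-against-r : (g : Q → ℕ) → ∑ points (λ q → g q * r q) ≡ ∑ curves (λ i → W i * ∑ params (λ a → g (t i a)))
    ∑-against-r g = begin
      ∑ points (λ q → g q * r q)                               ≡⟨ ∑-cong points (λ q → ∑-*ˡ curves (g q) _) ⟨
      ∑ points (λ q → ∑ curves (λ i → g q * (W i * hits i q))) ≡⟨ ∑-swap points curves _ ⟩
      ∑ curves (λ i → ∑ points (λ q → g q * (W i * hits i q))) ≡⟨ ∑-cong curves (λ i → ∑-cong points (λ q → x*[y*z]≡y*[x*z] (g q) (W i) _)) ⟩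
      ∑ curves (λ i → ∑ points (λ q → W i * (g q * hits i q))) ≡⟨ ∑-cong curves (λ i → trans (∑-*ˡ points (W i) _) (cong (W i *_) (∑-against-hits i g))) ⟩
      ∑ curves (λ i → W i * ∑ params (λ a → g (t i a)))        ∎
      where
      open ≡-Reasoning
      x*[y*z]≡y*[x*z] : ∀ x y z → x * (y * z) ≡ y * (x * z)
      x*[y*z]≡y*[x*z] = ℕSolver.solve-∀

    -- First moment: every curve contributes m incidences.
    mass : ∑ points r ≡ m * ∑ curves W
    mass = begin
      ∑ points r                                   ≡⟨ ∑-cong points (λ q → *-identityˡ (r q)) ⟨
      ∑ points (λ q → 1 * r q)                     ≡⟨ ∑-against-r (λ _ → 1) ⟩
      ∑ curves (λ i → W i * ∑ params (λ _ → 1))    ≡⟨ ∑-cong curves (λ i → cong (W i *_) (trans (∑-allFin-const m 1) (*-identityʳ m))) ⟩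
      ∑ curves (λ i → W i * m)                     ≡⟨ ∑-*ʳ curves m W ⟩
      ∑ curves W * m                               ≡⟨ *-comm (∑ curves W) m ⟩
      m * ∑ curves W                               ∎
      where open ≡-Reasoning

    -- Second moment: ∑ r² counts pairs of incidences, i.e. meetings of pairs of curves.
    energy : ∑ points (λ q → r q * r q) ≡ ∑ curves (λ i → W i * ∑ curves (λ j → W j * meet i j))
    energy = trans (∑-against-r r) (∑-cong curves (λ i → cong (W i *_) (begin
      ∑ params (λ a → ∑ curves (λ j → W j * hits j (t i a)))   ≡⟨ ∑-swap params curves _ ⟩
      ∑ curves (λ j → ∑ params (λ a → W j * hits j (t i a)))   ≡⟨ ∑-cong curves (λ j → ∑-*ˡ params (W j) _) ⟩
      ∑ curves (λ j → W j * meet i j)                          ∎)))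
      where open ≡-Reasoning

    hits-≤1 : ∀ j q → (∀ a₁ a₂ → t j a₁ ≡ t j a₂ → a₁ ≡ a₂) → hits j q ≤ 1
    hits-≤1 j q injective = ∑-≤1 (λ a → δ (t j a) q) (λ a → δ≤1 (t j a) q)
      (λ a₁ a₂ δ₁≢0 δ₂≢0 → injective a₁ a₂ (trans (δ≢0⇒≡ _ _ δ₁≢0) (sym (δ≢0⇒≡ _ _ δ₂≢0))))

    meet-≤-m : ∀ i j → (∀ a₁ a₂ → t j a₁ ≡ t j a₂ → a₁ ≡ a₂) → meet i j ≤ m
    meet-≤-m i j injective = begin
      meet i j                  ≤⟨ ∑-mono params (λ a → hits-≤1 j (t i a) injective) ⟩
      ∑ params (λ _ → 1)        ≡⟨ trans (∑-allFin-const m 1) (*-identityʳ m) ⟩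
      m                         ∎
      where open ≤-Reasoning

    meet-≤-1 : ∀ i j → (∀ a₁ a₂ → t j a₁ ≡ t j a₂ → a₁ ≡ a₂) →
      (∀ a₁ a₂ a₁′ a₂′ → t i a₁ ≡ t j a₁′ → t i a₂ ≡ t j a₂′ → a₁ ≡ a₂) → meet i j ≤ 1
    meet-≤-1 i j injective meets-once = ∑-≤1 (λ a → hits j (t i a)) (λ a → hits-≤1 j (t i a) injective) unique
      where
      common-point : ∀ a → ¬ hits j (t i a) ≡ 0 → ∃ λ a′ → t i a ≡ t j a′
      common-point a hits≢0 with ∑-witness params (λ a′ → δ (t j a′) (t i a)) hits≢0
      ... | a′ , δ≢0 = a′ , sym (δ≢0⇒≡ _ _ δ≢0)
      unique : ∀ a₁ a₂ → ¬ hits j (t i a₁) ≡ 0 → ¬ hits j (t i a₂) ≡ 0 → a₁ ≡ a₂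
      unique a₁ a₂ h₁ h₂ with common-point a₁ h₁ | common-point a₂ h₂
      ... | a₁′ , e₁ | a₂′ , e₂ = meets-once a₁ a₂ a₁′ a₂′ e₁ e₂

    ∑-meeting-bound : ∀ i → ∑ curves (λ j → W j * (1 + m * δI i j)) ≡ ∑ curves W + m * W i
    ∑-meeting-bound i = begin
      ∑ curves (λ j → W j * (1 + m * δI i j))       ≡⟨ ∑-cong curves (λ j → expand (W j) m (δI i j)) ⟩
      ∑ curves (λ j → W j + m * (δI i j * W j))     ≡⟨ ∑-+ curves W _ ⟩
      ∑ curves W + ∑ curves (λ j → m * (δI i j * W j)) ≡⟨ cong (∑ curves W +_) (trans (∑-*ˡ curves m _) (cong (m *_) (curves-enum i W))) ⟩
      ∑ curves W + m * W i                          ∎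
      where
      open ≡-Reasoning
      expand : ∀ w m d → w * (1 + m * d) ≡ w + m * (d * w)
      expand = ℕSolver.solve-∀

    energy-bound : (∀ i → W i ≤ 1) →
      (∀ i j → ¬ W i ≡ 0 → ¬ W j ≡ 0 → meet i j ≤ 1 + m * δI i j) →
      ∑ points (λ q → r q * r q) ≤ m * ∑ curves W + ∑ curves W * ∑ curves W
    energy-bound W≤1 meet-bound = begin
      ∑ points (λ q → r q * r q)
        ≡⟨ energy ⟩
      ∑ curves (λ i → W i * ∑ curves (λ j → W j * meet i j))
        ≡⟨ ∑-cong curves (λ i → ∑-*ˡ curves (W i) _) ⟨
      ∑ curves (λ i → ∑ curves (λ j → W i * (W j * meet i j)))
        ≤⟨ ∑-mono curves (λ i → ∑-mono curves (λ j → weighted-≤ (W i) (W j) (meet-bound i j))) ⟩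
      ∑ curves (λ i → ∑ curves (λ j → W i * (W j * (1 + m * δI i j))))
        ≡⟨ ∑-cong curves (λ i → trans (∑-*ˡ curves (W i) _) (cong (W i *_) (∑-meeting-bound i))) ⟩
      ∑ curves (λ i → W i * (L + m * W i))
        ≤⟨ ∑-mono curves (λ i → drop-square (W i) (W≤1 i)) ⟩
      ∑ curves (λ i → W i * L + m * W i)
        ≡⟨ trans (∑-+ curves _ _) (cong₂ _+_ (∑-*ʳ curves L W) (∑-*ˡ curves m W)) ⟩
      L * L + m * L
        ≡⟨ +-comm (L * L) (m * L) ⟩
      m * L + L * L ∎
      where
      open ≤-Reasoning
      L : ℕ
      L = ∑ curves W
      drop-square : ∀ w → w ≤ 1 → w * (L + m * w) ≤ w * L + m * w
      drop-square zero          _ = z≤n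
      drop-square (suc zero)    _ = ≤-reflexive (expand L m)
        where
        expand : ∀ L m → 1 * (L + m * 1) ≡ 1 * L + m * 1
        expand = ℕSolver.solve-∀
      drop-square (suc (suc _)) (s≤s ())

open Incidences

-- Arithmetic in 𝔽_p, p prime, carried out on integer representatives: x = 0 in 𝔽_p
-- means p ∣ x in ℤ.
module PrimeField (p : ℕ) .{{_ : NonZero p}} (p-prime : Prime p) where
  import Data.Nat as ℕ
  open import Data.Nat using (zero)
  import Data.Nat.Divisibility as ℕᵈ
  open import Data.Nat.DivMod using (_%_; _/_; _mod_; m≡m%n+[m/n]*n; m%n<n)
  open import Data.Nat.Primality using (euclidsLemma)
  open import Data.Integer using (ℤ; +_; _+_; _-_; _*_; -_; ∣_∣)
  open import Data.Integer.Divisibility.Signed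
    using (_∣_; divides; ∣ᵤ⇒∣; ∣⇒∣ᵤ; ∣m∣n⇒∣m+n; ∣m∣n⇒∣m-n; ∣n⇒∣m*n; ∣m⇒∣-m)
  open import Data.Integer.Tactic.RingSolver using (solve-∀)
  open import Data.Fin using (Fin; toℕ)
  import Data.Fin.Properties as Finₚ
  open import Data.Sum using (inj₁; inj₂)
  open import Data.Product using (_×_; _,_; proj₁; proj₂)
  open import Data.Empty using (⊥-elim)
  open import Relation.Nullary using (¬_; yes; no)
  open import Relation.Binary.PropositionalEquality

  infix 4 p∣_
  p∣_ : ℤ → Set
  p∣ x = + p ∣ x

  ∣-combination : ∀ α β {u v} → p∣ u → p∣ v → p∣ α * u + β * v
  ∣-combination α β p∣u p∣v = ∣m∣n⇒∣m+n (∣n⇒∣m*n α p∣u) (∣n⇒∣m*n β p∣v)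

  ∣-resp : ∀ {x y} → x ≡ y → p∣ y → p∣ x
  ∣-resp x≡y = subst (p∣_) (sym x≡y)

  ∣-cancelˡ : ∀ {c x} → ¬ (p∣ c) → p∣ c * x → p∣ x
  ∣-cancelˡ {c} {x} p∤c p∣cx
    with euclidsLemma ∣ c ∣ ∣ x ∣ p-prime (subst (p ℕᵈ.∣_) (ℤₚ.abs-* c x) (∣⇒∣ᵤ p∣cx))
  ... | inj₁ p∣c = ⊥-elim (p∤c (∣ᵤ⇒∣ p∣c))
  ... | inj₂ p∣x = ∣ᵤ⇒∣ p∣x

  ⟦_⟧ : Fin p → ℤ
  ⟦ x ⟧ = + toℕ x

  mod-residue : ∀ m → p∣ ⟦ m mod p ⟧ - + m
  mod-residue m = divides (- + (m / p)) (begin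
    + toℕ (m mod p) - + m               ≡⟨ cong (λ k → + k - + m) (Finₚ.toℕ-fromℕ< (m%n<n m p)) ⟩
    + (m % p) - + m                      ≡⟨ cong (λ k → + (m % p) - + k) (m≡m%n+[m/n]*n m p) ⟩
    + (m % p) - + (m % p ℕ.+ m / p ℕ.* p) ≡⟨ cong (λ k → + (m % p) - k) (trans (ℤₚ.pos-+ (m % p) _) (cong (λ k → + (m % p) + k) (ℤₚ.pos-* (m / p) p))) ⟩
    + (m % p) - (+ (m % p) + + (m / p) * + p) ≡⟨ cancel (+ (m % p)) (+ (m / p)) (+ p) ⟩
    - + (m / p) * + p                    ∎)
    where
    open ≡-Reasoning
    cancel : ∀ r q p → r - (r + q * p) ≡ - q * p
    cancel = solve-∀

  mulF-residue : ∀ x y → p∣ ⟦ mulF p x y ⟧ - ⟦ x ⟧ * ⟦ y ⟧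
  mulF-residue x y = subst (λ z → p∣ ⟦ mulF p x y ⟧ - z) (ℤₚ.pos-* (toℕ x) (toℕ y)) (mod-residue (toℕ x ℕ.* toℕ y))

  succF-residue : ∀ x → p∣ ⟦ succF p x ⟧ - (⟦ x ⟧ + + 1)
  succF-residue x = subst (λ z → p∣ ⟦ succF p x ⟧ - z) (ℤₚ.pos-+ (toℕ x) 1) (mod-residue (toℕ x ℕ.+ 1))

  small-multiple : ∀ k → k ℕ.< p → p∣ + k → k ≡ 0
  small-multiple zero    _   _    = refl
  small-multiple (suc k) k<p p∣k = ⊥-elim (ℕₚ.<⇒≱ k<p (ℕᵈ.∣⇒≤ (∣⇒∣ᵤ p∣k)))

  residue-nonzero : ∀ x → ¬ toℕ x ≡ 0 → ¬ (p∣ ⟦ x ⟧)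
  residue-nonzero x x≢0 p∣x = x≢0 (small-multiple (toℕ x) (Finₚ.toℕ<n x) p∣x)

  ordered-residues : ∀ {a b} → a ℕ.< p → b ℕ.≤ a → p∣ + a - + b → a ≡ b
  ordered-residues {a} {b} a<p b≤a p∣a-b = ℕₚ.≤-antisym (ℕₚ.m∸n≡0⇒m≤n a∸b≡0) b≤a
    where
    a∸b≡0 : a ℕ.∸ b ≡ 0
    a∸b≡0 = small-multiple (a ℕ.∸ b) (ℕₚ.≤-<-trans (ℕₚ.m∸n≤m a b) a<p)
      (subst (p∣_) (trans (ℤₚ.m-n≡m⊖n a b) (ℤₚ.⊖-≥ b≤a)) p∣a-b)

  residue-injective : ∀ x y → p∣ ⟦ x ⟧ - ⟦ y ⟧ → x ≡ y
  residue-injective x y p∣x-y with ℕₚ.≤-total (toℕ y) (toℕ x)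
  ... | inj₁ y≤x = Finₚ.toℕ-injective (ordered-residues (Finₚ.toℕ<n x) y≤x p∣x-y)
  ... | inj₂ x≤y = Finₚ.toℕ-injective (sym (ordered-residues (Finₚ.toℕ<n y) x≤y
                     (∣-resp (negate ⟦ y ⟧ ⟦ x ⟧) (∣m⇒∣-m p∣x-y))))
    where
    negate : ∀ u v → u - v ≡ - (v - u)
    negate = solve-∀

  -- The lines ℓ(b,c), ℓ(b′,c′) (c, b′ ≢ 0) sharing two points with distinct parameters
  -- a₁ ≢ a₂ on the first coincide modulo p: first the cross term b c′ − c b′ vanishes,
  -- from which c ≡ c′ and then b ≡ b′ follow.
  common-points⇒same-line : ∀ a₁ a₂ a₁′ a₂′ b c b′ c′ →
    ¬ (p∣ c) → ¬ (p∣ b′) → ¬ (p∣ a₁ - a₂) →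
    p∣ a₁ * b - a₁′ * b′ → p∣ (a₁ + + 1) * c - (a₁′ + + 1) * c′ →
    p∣ a₂ * b - a₂′ * b′ → p∣ (a₂ + + 1) * c - (a₂′ + + 1) * c′ →
    p∣ b - b′ × p∣ c - c′
  common-points⇒same-line a₁ a₂ a₁′ a₂′ b c b′ c′ p∤c p∤b′ p∤a₁-a₂ x₁ y₁ x₂ y₂ =
    p∣b-b′ , p∣c-c′
    where
    cross : p∣ b * c′ - c * b′
    cross = ∣-cancelˡ p∤a₁-a₂ (∣-resp (cross-identity a₁ a₂ a₁′ a₂′ b c b′ c′)
              (∣-combination c′ (- b′) (∣m∣n⇒∣m-n x₁ x₂) (∣m∣n⇒∣m-n y₁ y₂)))
      where
      cross-identity : ∀ a₁ a₂ a₁′ a₂′ b c b′ c′ → (a₁ - a₂) * (b * c′ - c * b′)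
        ≡ c′ * ((a₁ * b - a₁′ * b′) - (a₂ * b - a₂′ * b′))
          + - b′ * (((a₁ + + 1) * c - (a₁′ + + 1) * c′) - ((a₂ + + 1) * c - (a₂′ + + 1) * c′))
      cross-identity = solve-∀
    p∣c-c′ : p∣ c - c′
    p∣c-c′ = ∣-cancelˡ p∤b′ (∣-resp (c-identity a₁ a₁′ b c b′ c′)
               (∣m∣n⇒∣m+n (∣-combination b′ (- c′) y₁ x₁) (∣n⇒∣m*n a₁ cross)))
      where
      c-identity : ∀ a₁ a₁′ b c b′ c′ → b′ * (c - c′)
        ≡ (b′ * ((a₁ + + 1) * c - (a₁′ + + 1) * c′) + - c′ * (a₁ * b - a₁′ * b′)) + a₁ * (b * c′ - c * b′)
      c-identity = solve-∀
    p∣b-b′ : p∣ b - b′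
    p∣b-b′ = ∣-cancelˡ p∤c (∣-resp (b-identity b c b′ c′) (∣-combination b (+ 1) p∣c-c′ cross))
      where
      b-identity : ∀ b c b′ c′ → c * (b - b′) ≡ b * (c - c′) + + 1 * (b * c′ - c * b′)
      b-identity = solve-∀

  same-product⇒∣ : ∀ x y x′ y′ → mulF p x y ≡ mulF p x′ y′ → p∣ ⟦ x ⟧ * ⟦ y ⟧ - ⟦ x′ ⟧ * ⟦ y′ ⟧
  same-product⇒∣ x y x′ y′ eq = ∣-resp (difference ⟦ mulF p x y ⟧ (⟦ x ⟧ * ⟦ y ⟧) (⟦ x′ ⟧ * ⟦ y′ ⟧))
    (∣m∣n⇒∣m-n (subst (λ m → p∣ ⟦ m ⟧ - ⟦ x′ ⟧ * ⟦ y′ ⟧) (sym eq) (mulF-residue x′ y′)) (mulF-residue x y))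
    where
    difference : ∀ m u v → u - v ≡ (m - v) - (m - u)
    difference = solve-∀

  same-shifted-product⇒∣ : ∀ x z x′ z′ → mulF p (succF p x) z ≡ mulF p (succF p x′) z′ →
    p∣ (⟦ x ⟧ + + 1) * ⟦ z ⟧ - (⟦ x′ ⟧ + + 1) * ⟦ z′ ⟧
  same-shifted-product⇒∣ x z x′ z′ eq =
    ∣-resp (shift ⟦ succF p x ⟧ ⟦ succF p x′ ⟧ ⟦ x ⟧ ⟦ x′ ⟧ ⟦ z ⟧ ⟦ z′ ⟧)
      (∣m∣n⇒∣m+n (same-product⇒∣ (succF p x) z (succF p x′) z′ eq)
                  (∣-combination (- ⟦ z ⟧) ⟦ z′ ⟧ (succF-residue x) (succF-residue x′)))
    where
    shift : ∀ s s′ x x′ z z′ → (x + + 1) * z - (x′ + + 1) * z′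
          ≡ (s * z - s′ * z′) + (- z * (s - (x + + 1)) + z′ * (s′ - (x′ + + 1)))
    shift = solve-∀

  line : Fin p × Fin p → Fin p → Fin p × Fin p
  line (b , c) a = (mulF p a b , mulF p (succF p a) c)

  -- For b ≢ 0 the first coordinate ab already determines the parameter a.
  line-injective : ∀ {b c} → ¬ toℕ b ≡ 0 → ∀ a₁ a₂ → line (b , c) a₁ ≡ line (b , c) a₂ → a₁ ≡ a₂
  line-injective {b} {c} b≢0 a₁ a₂ eq = residue-injective a₁ a₂
    (∣-cancelˡ (residue-nonzero b b≢0) (∣-resp (factor ⟦ a₁ ⟧ ⟦ a₂ ⟧ ⟦ b ⟧)
      (same-product⇒∣ a₁ b a₂ b (cong proj₁ eq))))
    where
    factor : ∀ a₁ a₂ b → b * (a₁ - a₂) ≡ a₁ * b - a₂ * b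
    factor = solve-∀

  lines-meet-once : ∀ {b c b′ c′} → ¬ toℕ c ≡ 0 → ¬ toℕ b′ ≡ 0 → ¬ (b , c) ≡ (b′ , c′) →
    ∀ a₁ a₂ a₁′ a₂′ → line (b , c) a₁ ≡ line (b′ , c′) a₁′ → line (b , c) a₂ ≡ line (b′ , c′) a₂′ → a₁ ≡ a₂
  lines-meet-once {b} {c} {b′} {c′} c≢0 b′≢0 distinct a₁ a₂ a₁′ a₂′ e₁ e₂
    with a₁ Finₚ.≟ a₂
  ... | yes a₁≡a₂ = a₁≡a₂
  ... | no  a₁≢a₂ = ⊥-elim (distinct (cong₂ _,_ (residue-injective b b′ (proj₁ same))
                                               (residue-injective c c′ (proj₂ same))))
    where
    same : p∣ ⟦ b ⟧ - ⟦ b′ ⟧ × p∣ ⟦ c ⟧ - ⟦ c′ ⟧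
    same = common-points⇒same-line ⟦ a₁ ⟧ ⟦ a₂ ⟧ ⟦ a₁′ ⟧ ⟦ a₂′ ⟧ ⟦ b ⟧ ⟦ c ⟧ ⟦ b′ ⟧ ⟦ c′ ⟧
      (residue-nonzero c c≢0) (residue-nonzero b′ b′≢0)
      (λ p∣a₁-a₂ → a₁≢a₂ (residue-injective a₁ a₂ p∣a₁-a₂))
      (same-product⇒∣ a₁ b a₁′ b′ (cong proj₁ e₁)) (same-shifted-product⇒∣ a₁ c a₁′ c′ (cong proj₂ e₁))
      (same-product⇒∣ a₂ b a₂′ b′ (cong proj₁ e₂)) (same-shifted-product⇒∣ a₂ c a₂′ c′ (cong proj₂ e₂))

module Indicators where
  open import Data.Nat using (_≤_; z≤n; s≤s)
  open import Data.Bool using (true; false; if_then_else_)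
  open import Data.Fin using (Fin)
  open import Data.Fin.Subset using (_∈_; ∣_∣; inside; outside)
  open import Data.Fin.Subset.Properties using (_∈?_)
  import Data.Fin.Properties as Finₚ
  open import Data.Vec using ([]; _∷_)
  import Data.Vec.Properties as Vecₚ
  open import Data.List using (allFin)
  open import Data.Product using (_,_)
  open import Data.Empty using (⊥-elim)
  open import Relation.Nullary using (¬_; yes; no; does)
  open import Relation.Nullary.Decidable using (dec-true; _×-dec_)
  open import Relation.Binary.PropositionalEquality

  𝟙 : ∀ {n} → Subset n → Fin n → ℕ
  𝟙 S x = if does (x ∈? S) then 1 else 0

  𝟙≤1 : ∀ {n} (S : Subset n) x → 𝟙 S x ≤ 1
  𝟙≤1 S x with does (x ∈? S)
  ... | true  = s≤s z≤n
  ... | false = z≤n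

  ∈⇒𝟙≡1 : ∀ {n} (S : Subset n) {x} → x ∈ S → 𝟙 S x ≡ 1
  ∈⇒𝟙≡1 S {x} x∈S with x ∈? S
  ... | yes _   = refl
  ... | no  x∉S = ⊥-elim (x∉S x∈S)

  𝟙≢0⇒∈ : ∀ {n} (S : Subset n) {x} → ¬ 𝟙 S x ≡ 0 → x ∈ S
  𝟙≢0⇒∈ S {x} 𝟙≢0 with x ∈? S
  ... | yes x∈S = x∈S
  ... | no  _   = ⊥-elim (𝟙≢0 refl)

  ∣∣≡∑𝟙 : ∀ {n} (S : Subset n) → ∣ S ∣ ≡ ∑ (allFin n) (𝟙 S)
  ∣∣≡∑𝟙 []            = refl
  ∣∣≡∑𝟙 (inside  ∷ S) = trans (cong suc (∣∣≡∑𝟙 S)) (sym (∑-allFin-suc (𝟙 (inside ∷ S))))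
  ∣∣≡∑𝟙 (outside ∷ S) = trans (∣∣≡∑𝟙 S) (sym (∑-allFin-suc (𝟙 (outside ∷ S))))

  module _ (p : ℕ) .{{_ : NonZero p}} where

    ∈-prodSet : ∀ (X Y : Subset p) {x y} → x ∈ X → y ∈ Y → mulF p x y ∈ prodSet p X Y
    ∈-prodSet X Y {x} {y} x∈X y∈Y = Vecₚ.lookup⇒[]= (mulF p x y) (prodSet p X Y)
      (trans (Vecₚ.lookup∘tabulate _ (mulF p x y))
        (dec-true (Finₚ.any? λ u → Finₚ.any? λ v → (u ∈? X) ×-dec ((v ∈? Y) ×-dec (mulF p u v Finₚ.≟ mulF p x y)))
                  (x , y , x∈X , y∈Y , refl)))

    ∈-shiftSet : ∀ (X : Subset p) {x} → x ∈ X → succF p x ∈ shiftSet p X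
    ∈-shiftSet X {x} x∈X = Vecₚ.lookup⇒[]= (succF p x) (shiftSet p X)
      (trans (Vecₚ.lookup∘tabulate _ (succF p x))
        (dec-true (Finₚ.any? λ u → (u ∈? X) ×-dec (succF p u Finₚ.≟ succF p x)) (x , x∈X , refl)))

open Indicators

module LineConfiguration (k : ℕ) (p-prime : Prime (suc k)) (A B C : Subset (suc k))
  (B-units : InUnits (suc k) B) (C-units : InUnits (suc k) C) where
  open import Data.Nat using (_+_; _*_; _≤_; _⊓_; z≤n)
  open import Data.Nat.Properties
  open import Data.Fin using (Fin; toℕ)
  import Data.Fin.Properties as Finₚ
  open import Data.Fin.Subset using (_∈_; ∣_∣)
  open import Data.Fin.Subset.Properties using (_∈?_)
  open import Data.List using (List; allFin)
  open import Data.Product using (_×_; _,_; proj₁; proj₂)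
  open import Data.Product.Properties using (≡-dec)
  open import Relation.Nullary using (¬_; Dec; yes; no)
  open import Relation.Binary.Definitions using (DecidableEquality)
  open import Relation.Binary.PropositionalEquality

  p : ℕ
  p = suc k

  open PrimeField p p-prime using (line; line-injective; lines-meet-once)

  𝔽 : List (Fin p)
  𝔽 = allFin p

  𝔽² : List (Fin p × Fin p)
  𝔽² = pairs 𝔽 𝔽

  _≟²_ : DecidableEquality (Fin p × Fin p)
  _≟²_ = ≡-dec Finₚ._≟_ Finₚ._≟_

  𝔽²-enumerates : Enumerates _≟²_ 𝔽²
  𝔽²-enumerates = pairs-enumerates Finₚ._≟_ Finₚ._≟_ 𝔽 𝔽 (allFin-enumerates p) (allFin-enumerates p)

  -- The line ℓ(b,c) is counted iff b ∈ B and c ∈ C.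
  W : Fin p × Fin p → ℕ
  W q = 𝟙 B (proj₁ q) * 𝟙 C (proj₂ q)

  w : Fin p × Fin p → ℕ
  w q = 𝟙 (prodSet p A B) (proj₁ q) * 𝟙 (prodSet p (shiftSet p A) C) (proj₂ q)

  open CurveFamily _≟²_ _≟²_ 𝔽² 𝔽² 𝔽²-enumerates 𝔽²-enumerates p line W
  open Delta _≟²_ using (δ; δ-refl)

  size : ∑ 𝔽² (λ _ → 1) ≡ p * p
  size = begin
    ∑ 𝔽² (λ _ → 1)               ≡⟨ ∑-pairs 𝔽 𝔽 (λ _ → 1) ⟩
    ∑ 𝔽 (λ _ → ∑ 𝔽 (λ _ → 1))   ≡⟨ ∑-cong 𝔽 (λ _ → trans (∑-allFin-const p 1) (*-identityʳ p)) ⟩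
    ∑ 𝔽 (λ _ → p)               ≡⟨ ∑-allFin-const p p ⟩
    p * p                        ∎
    where open ≡-Reasoning

  ∑-indicator-product : (S T : Subset p) → ∑ 𝔽² (λ q → 𝟙 S (proj₁ q) * 𝟙 T (proj₂ q)) ≡ ∣ S ∣ * ∣ T ∣
  ∑-indicator-product S T = trans (∑-product 𝔽 𝔽 (𝟙 S) (𝟙 T)) (sym (cong₂ _*_ (∣∣≡∑𝟙 S) (∣∣≡∑𝟙 T)))

  counted-line : ∀ b c → ¬ W (b , c) ≡ 0 → b ∈ B × c ∈ C
  counted-line b c W≢0 =
    𝟙≢0⇒∈ B {b} (λ 𝟙≡0 → W≢0 (cong (_* 𝟙 C c) 𝟙≡0)) ,
    𝟙≢0⇒∈ C {c} (λ 𝟙≡0 → W≢0 (trans (cong (𝟙 B b *_) 𝟙≡0) (*-zeroʳ (𝟙 B b))))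

  meet-bound : ∀ i j → ¬ W i ≡ 0 → ¬ W j ≡ 0 → meet i j ≤ 1 + p * δ i j
  meet-bound (b , c) (b′ , c′) Wi≢0 Wj≢0 = by-cases ((b , c) ≟² (b′ , c′))
    where
    c≢0 : ¬ toℕ c ≡ 0
    c≢0 = C-units c (proj₂ (counted-line b c Wi≢0))
    b′≢0 : ¬ toℕ b′ ≡ 0
    b′≢0 = B-units b′ (proj₁ (counted-line b′ c′ Wj≢0))
    by-cases : Dec ((b , c) ≡ (b′ , c′)) → meet (b , c) (b′ , c′) ≤ 1 + p * δ (b , c) (b′ , c′)
    by-cases (yes refl) = begin
      meet (b , c) (b , c)          ≤⟨ meet-≤-m (b , c) (b , c) (line-injective b′≢0) ⟩
      p                             ≤⟨ m≤n+m p 1 ⟩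
      1 + p                         ≡⟨ cong (1 +_) (*-identityʳ p) ⟨
      1 + p * 1                     ≡⟨ cong (λ d → 1 + p * d) (δ-refl (b , c)) ⟨
      1 + p * δ (b , c) (b , c)     ∎
      where open ≤-Reasoning
    by-cases (no i≢j) = ≤-trans
      (meet-≤-1 (b , c) (b′ , c′) (line-injective b′≢0) (lines-meet-once c≢0 b′≢0 i≢j))
      (m≤m+n 1 _)

  𝟙A≤w : ∀ b c a → b ∈ B → c ∈ C → 𝟙 A a ≤ w (line (b , c) a)
  𝟙A≤w b c a b∈B c∈C with a ∈? A
  ... | no  _   = z≤n
  ... | yes a∈A = ≤-reflexive (sym (cong₂ _*_
        (∈⇒𝟙≡1 (prodSet p A B) (∈-prodSet p A B a∈A b∈B))
        (∈⇒𝟙≡1 (prodSet p (shiftSet p A) C) (∈-prodSet p (shiftSet p A) C (∈-shiftSet p A a∈A) c∈C))))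

  L : ℕ
  L = ∑ 𝔽² W

  incidence-lower-bound : ∣ A ∣ * L ≤ ∑ 𝔽² (λ q → w q * r q)
  incidence-lower-bound = begin
    ∣ A ∣ * L                                        ≡⟨ *-comm ∣ A ∣ L ⟩
    L * ∣ A ∣                                        ≡⟨ ∑-*ʳ 𝔽² ∣ A ∣ W ⟨
    ∑ 𝔽² (λ i → W i * ∣ A ∣)                         ≡⟨ ∑-cong 𝔽² (λ i → cong (W i *_) (∣∣≡∑𝟙 A)) ⟩
    ∑ 𝔽² (λ i → W i * ∑ 𝔽 (𝟙 A))                     ≤⟨ ∑-mono 𝔽² (λ i → *-monoʳ-≤-where-nonzero (W i) (on-line i)) ⟩
    ∑ 𝔽² (λ i → W i * ∑ 𝔽 (λ a → w (line i a)))      ≡⟨ ∑-against-r w ⟨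
    ∑ 𝔽² (λ q → w q * r q)                           ∎
    where
    open ≤-Reasoning
    on-line : ∀ i → ¬ W i ≡ 0 → ∑ 𝔽 (𝟙 A) ≤ ∑ 𝔽 (λ a → w (line i a))
    on-line (b , c) W≢0 = ∑-mono 𝔽 (λ a → 𝟙A≤w b c a (proj₁ counted) (proj₂ counted))
      where
      counted : b ∈ B × c ∈ C
      counted = counted-line b c W≢0

  W≤1 : ∀ i → W i ≤ 1
  W≤1 (b , c) = *-mono-≤ (𝟙≤1 B b) (𝟙≤1 C c)

  w≤1 : ∀ q → w q ≤ 1
  w≤1 (x , y) = *-mono-≤ (𝟙≤1 _ x) (𝟙≤1 _ y)

  bound : (p * p * ∣ A ∣) ⊓ (∣ A ∣ * ∣ A ∣ * L) ≤ 4 * p * ∑ 𝔽² w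
  bound = min-bound p L ∣ A ∣ n incidences incidence-lower-bound deviation-bound
    where open SecondMoment 𝔽² r w p L size mass (energy-bound W≤1 meet-bound) w≤1

  L≡∣B∣∣C∣ : L ≡ ∣ B ∣ * ∣ C ∣
  L≡∣B∣∣C∣ = ∑-indicator-product B C

  ∑w≡∣AB∣∣[A+1]C∣ : ∑ 𝔽² w ≡ ∣ prodSet p A B ∣ * ∣ prodSet p (shiftSet p A) C ∣
  ∑w≡∣AB∣∣[A+1]C∣ = ∑-indicator-product (prodSet p A B) (prodSet p (shiftSet p A) C)

open import Data.Nat using (zero; _*_; _≤_; _⊓_; _≥_; s≤s; z≤n)
open import Data.Nat.Properties using (*-assoc; module ≤-Reasoning)
open import Data.Nat.Primality using (¬prime[0])
open import Data.Fin.Subset using (Nonempty; ∣_∣)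
open import Data.Product using (Σ; _×_; _,_)
open import Data.Empty using (⊥-elim)
open import Relation.Binary.PropositionalEquality using (cong; sym; trans)

-- The theorem, with implied constant 1/4: the lines ℓ(b,c) give
-- min(p²|A|, |A|²|B||C|) ≤ 4p·|AB||(A+1)C|.  (The hypotheses that A, B, C are nonempty and
-- that A avoids 0 are not needed.)
theorem2 : Σ ℕ λ k → k ≥ 1 ×
    ((p : ℕ) → .{{_ : NonZero p}} → Prime p →
    (A B C : Subset p) →
    Nonempty A → Nonempty B → Nonempty C →
    InUnits p A → InUnits p B → InUnits p C →
    (p * p * ∣ A ∣) ⊓ (∣ A ∣ * ∣ A ∣ * ∣ B ∣ * ∣ C ∣)
    ≤ k * p * (∣ prodSet p A B ∣ * ∣ prodSet p (shiftSet p A) C ∣))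
theorem2 = 4 , s≤s z≤n , bound-with-constant-4
  where
  bound-with-constant-4 : (p : ℕ) → .{{_ : NonZero p}} → Prime p →
    (A B C : Subset p) →
    Nonempty A → Nonempty B → Nonempty C →
    InUnits p A → InUnits p B → InUnits p C →
    (p * p * ∣ A ∣) ⊓ (∣ A ∣ * ∣ A ∣ * ∣ B ∣ * ∣ C ∣)
    ≤ 4 * p * (∣ prodSet p A B ∣ * ∣ prodSet p (shiftSet p A) C ∣)
  bound-with-constant-4 zero    p-prime = ⊥-elim (¬prime[0] p-prime)
  bound-with-constant-4 (suc k) p-prime A B C _ _ _ _ B-units C-units = begin
    (p * p * ∣ A ∣) ⊓ (∣ A ∣ * ∣ A ∣ * ∣ B ∣ * ∣ C ∣)
      ≡⟨ cong ((p * p * ∣ A ∣) ⊓_) (trans (*-assoc (∣ A ∣ * ∣ A ∣) ∣ B ∣ ∣ C ∣) (cong (∣ A ∣ * ∣ A ∣ *_) (sym L≡∣B∣∣C∣))) ⟩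
    (p * p * ∣ A ∣) ⊓ (∣ A ∣ * ∣ A ∣ * L)
      ≤⟨ bound ⟩
    4 * p * ∑ 𝔽² w
      ≡⟨ cong (4 * p *_) ∑w≡∣AB∣∣[A+1]C∣ ⟩
    4 * p * (∣ prodSet p A B ∣ * ∣ prodSet p (shiftSet p A) C ∣) ∎
    where
    open LineConfiguration k p-prime A B C B-units C-units
    open ≤-Reasoning
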